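{- Let $R$ be a commutative ring, $B,C,D\in R$, and $h=\operatorname{EDS}(B,C,D)$. Then $h_3h_2\mid h_{n+1}h_nh_{n-1}$ in $R$ for every $n\in\mathbb{Z}$.
   Context: Given $B,C,D$ in a commutative ring $R$, define $(\tilde h_n)_{n\in\mathbb{Z}}$ by $\tilde h_0=0$, $\tilde h_1=\tilde h_2=1$, $\tilde h_3=C$, $\tilde h_4=D$, and $\tilde h_{2n+1}=B^4\tilde h_{n+2}\tilde h_n^3-\tilde h_{n-1}\tilde h_{n+1}^3$ for even $n\ge2$; $\tilde h_{2n+1}=\tilde h_{n+2}\tilde h_n^3-B^4\tilde h_{n-1}\tilde h_{n+1}^3$ for odd $n\ge3$; $\tilde h_{2n}=\tilde h_n(\tilde h_{n+2}\tilde h_{n-1}^2-\tilde h_{n+1}^2\tilde h_{n-2})$ for $n\ge3$; $\tilde h_n=-\tilde h_{ -n}$ for $n<0$. The standard EDS $\operatorname{EDS}(B,C,D)$ is the sequence $(h_n)_{n\in\mathbb{Z}}$ with $h_n=\tilde h_n$ for $n$ odd and $h_n=B\tilde h_n$ for $n$ even. -}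

module Defs where

open import Level using (Level)
open import Data.Nat as ℕ using (ℕ; zero; suc; _∸_; ⌊_/2⌋)
open import Data.Integer as ℤ using (ℤ; +_; -[1+_])
open import Data.Bool using (Bool; true; false; if_then_else_)
open import Algebra.Bundles using (CommutativeRing)
import Algebra.Definitions.RawMagma as RawMagmaDefs

isEven : ℕ → Bool
isEven zero = true
isEven (suc zero) = false
isEven (suc (suc n)) = isEven n

isEvenℤ : ℤ → Bool
isEvenℤ z = isEven ℤ.∣ z ∣

module EDS {c ℓ : Level} (R : CommutativeRing c ℓ) where
  open CommutativeRing R

  open RawMagmaDefs *-rawMagma public using (_∣_)

  _^4 : Carrier → Carrier
  x ^4 = x * x * x * x

  _^3 : Carrier → Carrier
  x ^3 = x * x * x

  _^2 : Carrier → Carrier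
  x ^2 = x * x

  -- Fuel-based computation of h̃_m for m ≥ 0.  Every recursive call is to an
  -- index strictly smaller than m, so with fuel (suc m) the value is the
  -- genuine h̃_m (the fuel never runs out before reaching the base cases).
  hfuel : Carrier → Carrier → Carrier → ℕ → ℕ → Carrier
  hfuel B C D zero _ = 0#
  hfuel B C D (suc k) 0 = 0#
  hfuel B C D (suc k) 1 = 1#
  hfuel B C D (suc k) 2 = 1#
  hfuel B C D (suc k) 3 = C
  hfuel B C D (suc k) 4 = D
  hfuel B C D (suc k) m@(suc (suc (suc (suc (suc _))))) =
    if isEven m
      -- m = 2n, n ≥ 3
      then h n * (h (n ℕ.+ 2) * (h (n ∸ 1)) ^2 - (h (n ℕ.+ 1)) ^2 * h (n ∸ 2))
      -- m = 2n+1, n ≥ 2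
      else (if isEven n
              then B ^4 * h (n ℕ.+ 2) * (h n) ^3 - h (n ∸ 1) * (h (n ℕ.+ 1)) ^3
              else h (n ℕ.+ 2) * (h n) ^3 - B ^4 * h (n ∸ 1) * (h (n ℕ.+ 1)) ^3)
    where
      n : ℕ
      n = ⌊ m /2⌋
      h : ℕ → Carrier
      h = hfuel B C D k

  htildeℕ : Carrier → Carrier → Carrier → ℕ → Carrier
  htildeℕ B C D m = hfuel B C D (suc m) m

  htilde : Carrier → Carrier → Carrier → ℤ → Carrier
  htilde B C D (+ m) = htildeℕ B C D m
  htilde B C D -[1+ m ] = - htildeℕ B C D (suc m)

  EDS : Carrier → Carrier → Carrier → ℤ → Carrier
  EDS B C D n = if isEvenℤ n then B * htilde B C D n else htilde B C D n

{-# OPTIONS --safe #-}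
-- Here h₃h₂ = C·B.  If 3 ∣ m, every term of the recursion formula for h̃ₘ contains a
-- factor h̃ⱼ with 3 ∣ j (j = n for m = 2n; j = n + 2 and j = n - 1 for m = 2n + 1, as
-- then n ≡ 1 mod 3), so C ∣ h̃ₘ whenever 3 ∣ m.  Among three consecutive indices one is a
-- multiple k of 3: if k is even then C·B ∣ B·h̃ₖ = hₖ, and otherwise a neighbour of k is
-- even and its factor supplies the B.  As h₋ₘ = ±hₘ, negative indices reduce to this.
module Submission where

open import Defs
open import Level using (Level)
open import Data.Integer using (ℤ; +_; -[1+_]) renaming (_+_ to _ℤ+_; _-_ to _ℤ-_)
open import Algebra.Bundles using (CommutativeRing)
open import Algebra.Bundles using (Ring)
open import Data.Bool using (true; false; if_then_else_)
open import Data.Nat as ℕ using (ℕ; zero; suc; _∸_; ⌊_/2⌋)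
open import Data.Nat.Divisibility using (divides; ∣-refl; ∣m∣n⇒∣m+n) renaming (_∣_ to _∣ℕ_)
import Data.Nat.Properties as ℕₚ
open import Data.Product using (∃-syntax; _×_; _,_; proj₁; proj₂)
open import Data.Sum using (_⊎_; inj₁; inj₂)
open import Relation.Binary.PropositionalEquality using (_≡_; refl; cong)

even-or-suc-even : ∀ a → isEven a ≡ true ⊎ isEven (suc a) ≡ true
even-or-suc-even zero          = inj₁ refl
even-or-suc-even (suc zero)    = inj₂ refl
even-or-suc-even (suc (suc a)) = even-or-suc-even a

3∣-one-of-three-consecutive : ∀ a → 3 ∣ℕ a ⊎ 3 ∣ℕ suc a ⊎ 3 ∣ℕ suc (suc a)
3∣-one-of-three-consecutive zero = inj₁ (divides 0 refl)
3∣-one-of-three-consecutive (suc a) with 3∣-one-of-three-consecutive a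
... | inj₁ 3∣a             = inj₂ (inj₂ (∣m∣n⇒∣m+n ∣-refl 3∣a))
... | inj₂ (inj₁ 3∣a+1)    = inj₁ 3∣a+1
... | inj₂ (inj₂ 3∣a+2)    = inj₂ (inj₁ 3∣a+2)

half-of-even-multiple-of-3 : ∀ {m} → isEven m ≡ true → 3 ∣ℕ m → 3 ∣ℕ ⌊ m /2⌋
half-of-even-multiple-of-3 even (divides q refl) = go q even
  where
  go : ∀ q → isEven (q ℕ.* 3) ≡ true → 3 ∣ℕ ⌊ q ℕ.* 3 /2⌋
  go zero          _    = divides 0 refl
  go (suc zero)    ()
  go (suc (suc q)) even = ∣m∣n⇒∣m+n ∣-refl (go q even)

half-of-odd-multiple-of-3 : ∀ {m} → isEven m ≡ false → 3 ∣ℕ m → ∃[ k ] ⌊ m /2⌋ ≡ suc (k ℕ.* 3)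
half-of-odd-multiple-of-3 odd (divides q refl) = go q odd
  where
  go : ∀ q → isEven (q ℕ.* 3) ≡ false → ∃[ k ] ⌊ q ℕ.* 3 /2⌋ ≡ suc (k ℕ.* 3)
  go zero          ()
  go (suc zero)    _   = 0 , refl
  go (suc (suc q)) odd with go q odd
  ... | k , eq = suc k , cong (λ n → suc (suc (suc n))) eq

half-of-odd-multiple-of-3-shifts : ∀ {m} → isEven m ≡ false → 3 ∣ℕ m →
                                   3 ∣ℕ ⌊ m /2⌋ ℕ.+ 2 × 3 ∣ℕ ⌊ m /2⌋ ∸ 1
half-of-odd-multiple-of-3-shifts {m} odd 3∣m with ⌊ m /2⌋ | half-of-odd-multiple-of-3 odd 3∣m
... | _ | k , refl = divides (suc k) (ℕₚ.+-comm (suc (k ℕ.* 3)) 2) , divides k refl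

module RingDivisibility {c ℓ} (R : Ring c ℓ) where
  open Ring R
  open import Algebra.Definitions.RawMagma *-rawMagma using (_∣_; _,_)
  open import Algebra.Properties.Ring R using (-1*x≈-x; [y-z]x≈yx-zx)

  x∣-x : ∀ x → x ∣ - x
  x∣-x x = - 1# , -1*x≈-x x

  x∣y∧x∣z⇒x∣y-z : ∀ {x y z} → x ∣ y → x ∣ z → x ∣ y - z
  x∣y∧x∣z⇒x∣y-z {x} (p , px≈y) (q , qx≈z) =
    p - q , trans ([y-z]x≈yx-zx x p q) (+-cong px≈y (-‿cong qx≈z))

module EDSDivisibility {c ℓ} (R : CommutativeRing c ℓ) where
  open CommutativeRing R renaming (refl to ≈-refl)
  open EDS R
  open RingDivisibility ring
  open import Algebra.Properties.Ring ring using (-‿distribʳ-*)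
  open import Algebra.Properties.CommutativeSemigroup *-commutativeSemigroup using (xy∙z≈zy∙x)
  open import Algebra.Properties.CommutativeSemigroup.Divisibility *-commutativeSemigroup
    using (∣ʳ-trans; x∣xy; x∣ʳy⇒x∣ʳzy; x∣ʳy⇒xz∣ʳyz; ∙-cong-∣; ∣-respʳ-≈; ∣-respˡ-≈)
  open import Algebra.Properties.Semiring.Divisibility semiring using (_∣0)
  open import Algebra.Properties.Monoid.Divisibility *-monoid using (∣ʳ-refl)

  x∣y⇒x∣yz : ∀ {x y} z → x ∣ y → x ∣ y * z
  x∣y⇒x∣yz {y = y} z x∣y = ∣ʳ-trans x∣y (x∣xy y z)

  ∣-odd-formula : ∀ {d a y₁ y₂ y₃ y₄} b → d ∣ y₁ → d ∣ y₂ →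
                  d ∣ (if b then a * y₁ * y₃ ^3 - y₂ * y₄ ^3 else y₁ * y₃ ^3 - a * y₂ * y₄ ^3)
  ∣-odd-formula true  d∣y₁ d∣y₂ = x∣y∧x∣z⇒x∣y-z (x∣y⇒x∣yz _ (x∣ʳy⇒x∣ʳzy _ d∣y₁)) (x∣y⇒x∣yz _ d∣y₂)
  ∣-odd-formula false d∣y₁ d∣y₂ = x∣y∧x∣z⇒x∣y-z (x∣y⇒x∣yz _ d∣y₁) (x∣y⇒x∣yz _ (x∣ʳy⇒x∣ʳzy _ d∣y₂))

  module _ (B C D : Carrier) where

    h : ℕ → Carrier
    h m = EDS B C D (+ m)

    -- Any fuel k will do: when the fuel runs out the value is 0#.
    C∣hfuel : ∀ k m → 3 ∣ℕ m → C ∣ hfuel B C D k m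
    C∣hfuel zero    m _ = C ∣0
    C∣hfuel (suc k) 0 _ = C ∣0
    C∣hfuel (suc k) 1 (divides (suc _) ())
    C∣hfuel (suc k) 2 (divides (suc _) ())
    C∣hfuel (suc k) 3 _ = ∣ʳ-refl
    C∣hfuel (suc k) 4 (divides (suc (suc _)) ())
    C∣hfuel (suc k) m@(suc (suc (suc (suc (suc _))))) 3∣m with isEven m in parity
    ... | true = x∣y⇒x∣yz _ (C∣hfuel k ⌊ m /2⌋ (half-of-even-multiple-of-3 parity 3∣m))
    ... | false = ∣-odd-formula (isEven ⌊ m /2⌋) (C∣hfuel k _ 3∣n+2) (C∣hfuel k _ 3∣n∸1)
      where
      3∣n+2 : 3 ∣ℕ ⌊ m /2⌋ ℕ.+ 2
      3∣n+2 = proj₁ (half-of-odd-multiple-of-3-shifts parity 3∣m)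
      3∣n∸1 : 3 ∣ℕ ⌊ m /2⌋ ∸ 1
      3∣n∸1 = proj₂ (half-of-odd-multiple-of-3-shifts parity 3∣m)

    C∣htilde : ∀ {m} → 3 ∣ℕ m → C ∣ htildeℕ B C D m
    C∣htilde {m} = C∣hfuel (suc m) m

    C∣h : ∀ {m} → 3 ∣ℕ m → C ∣ h m
    C∣h {m} 3∣m with isEven m
    ... | true  = x∣ʳy⇒x∣ʳzy B (C∣htilde 3∣m)
    ... | false = C∣htilde 3∣m

    B∣h : ∀ m → isEven m ≡ true → B ∣ h m
    B∣h m even rewrite even = x∣xy B (htildeℕ B C D m)

    CB∣h : ∀ {m} → isEven m ≡ true → 3 ∣ℕ m → C * B ∣ h m
    CB∣h {m} even 3∣m rewrite even = ∣-respʳ-≈ (*-comm _ B) (x∣ʳy⇒xz∣ʳyz B (C∣htilde 3∣m))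

    CB∣h-consecutive : ∀ a → C * B ∣ h a * h (suc a) * h (suc (suc a))
    CB∣h-consecutive a with 3∣-one-of-three-consecutive a | even-or-suc-even a
    ... | inj₁ 3∣a          | inj₁ a-even   = x∣y⇒x∣yz _ (x∣y⇒x∣yz _ (CB∣h a-even 3∣a))
    ... | inj₁ 3∣a          | inj₂ a+1-even = x∣y⇒x∣yz _ (∙-cong-∣ (C∣h 3∣a) (B∣h (suc a) a+1-even))
    ... | inj₂ (inj₁ 3∣a+1) | inj₁ a-even   =
      x∣y⇒x∣yz _ (∣-respˡ-≈ (*-comm B C) (∙-cong-∣ (B∣h a a-even) (C∣h 3∣a+1)))
    ... | inj₂ (inj₁ 3∣a+1) | inj₂ a+1-even = x∣y⇒x∣yz _ (x∣ʳy⇒x∣ʳzy _ (CB∣h a+1-even 3∣a+1))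
    ... | inj₂ (inj₂ 3∣a+2) | inj₁ a-even   = x∣ʳy⇒x∣ʳzy _ (CB∣h a-even 3∣a+2)
    ... | inj₂ (inj₂ 3∣a+2) | inj₂ a+1-even =
      ∣-respʳ-≈ (sym (*-assoc _ _ _))
        (x∣ʳy⇒x∣ʳzy _ (∣-respˡ-≈ (*-comm B C) (∙-cong-∣ (B∣h (suc a) a+1-even) (C∣h 3∣a+2))))

    EDS-negative : ∀ k → EDS B C D -[1+ k ] ≈ - h (suc k)
    EDS-negative k with isEven (suc k)
    ... | true  = sym (-‿distribʳ-* B _)
    ... | false = ≈-refl

    h∣EDS-negative : ∀ k → h (suc k) ∣ EDS B C D -[1+ k ]
    h∣EDS-negative k = ∣-respʳ-≈ (sym (EDS-negative k)) (x∣-x _)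

    ∣h0 : ∀ x → x ∣ h 0
    ∣h0 x = ∣-respʳ-≈ (sym (zeroʳ B)) (x ∣0)

    CB∣EDS-consecutive : ∀ n →
                         C * B ∣ EDS B C D (n ℤ+ + 1) * EDS B C D n * EDS B C D (n ℤ- + 1)
    CB∣EDS-consecutive (+ zero)              = x∣y⇒x∣yz _ (x∣ʳy⇒x∣ʳzy _ (∣h0 _))
    CB∣EDS-consecutive (+ suc m) rewrite ℕₚ.+-comm m 1 =
      ∣-respʳ-≈ (xy∙z≈zy∙x _ _ _) (CB∣h-consecutive m)
    CB∣EDS-consecutive -[1+ zero ]           = x∣y⇒x∣yz _ (x∣y⇒x∣yz _ (∣h0 _))
    CB∣EDS-consecutive -[1+ suc m ] rewrite ℕₚ.+-identityʳ m =
      ∣ʳ-trans (CB∣h-consecutive (suc m))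
        (∙-cong-∣ (∙-cong-∣ (h∣EDS-negative m) (h∣EDS-negative (suc m)))
                  (h∣EDS-negative (suc (suc m))))

mainTheorem9 : {c ℓ : Level} (R : CommutativeRing c ℓ) →
    let open CommutativeRing R in
    let open EDS R in
    (B C D : Carrier) (n : ℤ) →
      (EDS B C D (+ 3) * EDS B C D (+ 2))
        ∣ (EDS B C D (n ℤ+ + 1) * EDS B C D n * EDS B C D (n ℤ- + 1))
mainTheorem9 R B C D n =
  -- h₃ h₂ computes to C * (B * 1#)
  ∣-respˡ-≈ (*-congˡ (sym (*-identityʳ B))) (CB∣EDS-consecutive B C D n)
  where
  open CommutativeRing R
  open EDSDivisibility R
  open import Algebra.Properties.CommutativeSemigroup.Divisibility *-commutativeSemigroup using (∣-respˡ-≈)
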